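{- Let $d$ be the number of deletions made by the optimal algorithm. If at time $t$ (up to and including $t$) the number of indices in $A_t^{OPT}$ that the optimal algorithm deletes is $d_t$ and $|A_t^{OPT}\setminus A_t|=r_t$, then at most $r_t+(d-d_t)$ edits suffice to convert $S_t$ into a well-balanced string.
   Context: $T$ is a finite set of open parentheses, each $x\in T$ with unique congruent close parenthesis $\bar{x}$; well-balanced means belonging to the Dyck language $S\to SS\mid\varepsilon\mid aS\bar{a}$. Input $\sigma=\sigma[1]\cdots\sigma[n]$ over $T\cup\bar{T}$. Random-deletion: scan left to right with a stack; push open parentheses; on a close parenthesis, delete it if the stack is empty, match (pop) it with the stack top if they match, and otherwise delete either the stack top or the current symbol with probability $1/2$ each independently; after the scan, delete the remaining stack symbols one at a time. Time starts at $t=0$ and increases by one at every match or deletion. $S_t$ is $\sigma$ with all symbols deleted by Random-deletion up to and including time $t$ removed. Fix an optimal deletion-only solution ("the optimal algorithm"): a stack-based single-scan procedure that pushes opens, pops on a match and on a mismatch deletes the stack top or the current close parenthesis, using exactly the minimum number $d$ of deletions needed to make $\sigma$ well-balanced; it determines which indices are deleted and which pairs are matched. $A_t$ is the set of indices matched or deleted by Random-deletion up to and including time $t$; $A_t^{OPT}=\{i : i\in A_t \text{ or } i \text{ is matched by the optimal algorithm with some index in } A_t\}$. -}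

module Defs where

open import Data.Bool using (Bool; true; false; _∧_; _∨_; not; if_then_else_)
open import Data.Nat using (ℕ; zero; suc; _+_; _≡ᵇ_)
open import Data.Fin using (Fin)
open import Data.Fin.Properties using () renaming (_≟_ to _≟F_)
open import Data.List using (List; []; _∷_; map; take; filterᵇ; upTo; zip; length)
open import Data.Bool.ListAction using (any)
open import Data.Product using (_×_; _,_; proj₁; proj₂)
open import Relation.Nullary using (yes; no)

-- Parentheses over a finite set T = Fin k of types:
-- op a is the open parenthesis a, cl a its congruent close parenthesis ā.
data Sym (k : ℕ) : Set where
  op : Fin k → Sym k
  cl : Fin k → Sym k

data Balanced {k : ℕ} : List (Sym k) → Set where
  bal-ε    : Balanced []
  bal-cat  : ∀ {u v} → Balanced u → Balanced v → Balanced (u Data.List.++ v)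
  bal-wrap : ∀ a {u} → Balanced u → Balanced (op a ∷ u Data.List.++ (cl a ∷ []))

-- Events of the stack procedure; indices are 0-based positions in σ.
data Event : Set where
  del : ℕ → Event
  mat : ℕ → ℕ → Event

-- The choice made at the
-- m-th mismatch is coins m  (true = delete stack top, false = delete the
-- current close parenthesis).  Random-deletion = this procedure with
-- independent fair coins; the optimal algorithm = this procedure with some
-- fixed choice sequence achieving the minimum number of deletions.
-- Arguments: coins, mismatch counter, current position, stack (head = top).
mutual
  scan : {k : ℕ} → (ℕ → Bool) → ℕ → ℕ → List (ℕ × Fin k) → List (Sym k) → List Event
  scan c m p st [] = map (λ q → del (proj₁ q)) st
  scan c m p st (op a ∷ σ) = scan c m (suc p) ((p , a) ∷ st) σ
  scan c m p st (cl a ∷ σ) = closeStep c m p a st σ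

  closeStep : {k : ℕ} → (ℕ → Bool) → ℕ → ℕ → Fin k → List (ℕ × Fin k) → List (Sym k) → List Event
  closeStep c m p a [] σ = del p ∷ scan c m (suc p) [] σ
  closeStep c m p a ((q , b) ∷ st) σ with b ≟F a
  ... | yes _ = mat q p ∷ scan c m (suc p) st σ
  ... | no _ with c m
  ...   | true  = del q ∷ closeStep c (suc m) p a st σ
  ...   | false = del p ∷ scan c (suc m) (suc p) ((q , b) ∷ st) σ

run : {k : ℕ} → (ℕ → Bool) → List (Sym k) → List Event
run c σ = scan c 0 0 [] σ

open import Data.List.Relation.Binary.Sublist.Propositional public using (_⊆_)
open import Relation.Binary.PropositionalEquality using (_≡_)
open import Data.Nat using (_≤_)

numDel : List Event → ℕ
numDel [] = 0
numDel (del _ ∷ es) = suc (numDel es)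
numDel (mat _ _ ∷ es) = numDel es

MinDeletions : {k : ℕ} → List (Sym k) → ℕ → Set
MinDeletions σ d =
  (Data.Product.Σ (List _) λ τ → τ ⊆ σ × Balanced τ × length σ ≡ d + length τ)
  × (∀ τ → τ ⊆ σ → Balanced τ → d + length τ ≤ length σ)

count : (ℕ → Bool) → List ℕ → ℕ
count f xs = length (filterᵇ f xs)

isDel : ℕ → Event → Bool
isDel i (del j) = i ≡ᵇ j
isDel i (mat _ _) = false

touches : ℕ → Event → Bool
touches i (del j) = i ≡ᵇ j
touches i (mat j l) = (i ≡ᵇ j) ∨ (i ≡ᵇ l)

pairs : ℕ → ℕ → Event → Bool
pairs i j (del _) = false
pairs i j (mat a b) = ((a ≡ᵇ i) ∧ (b ≡ᵇ j)) ∨ ((a ≡ᵇ j) ∧ (b ≡ᵇ i))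

-- Events of the first t steps (times 1..t; time increases by one per event).
upToTime : ℕ → List Event → List Event
upToTime t es = take t es

inA : List Event → ℕ → ℕ → Bool
inA rd t i = any (touches i) (upToTime t rd)

inAOPT : ℕ → List Event → List Event → ℕ → ℕ → Bool
inAOPT n rd opt t i =
  inA rd t i ∨ any (λ j → inA rd t j ∧ any (pairs i j) opt) (upTo n)

optDeletes : List Event → ℕ → Bool
optDeletes opt i = any (isDel i) opt

dT : {k : ℕ} → List (Sym k) → List Event → List Event → ℕ → ℕ
dT σ rd opt t = count (λ i → inAOPT (length σ) rd opt t i ∧ optDeletes opt i) (upTo (length σ))

rT : {k : ℕ} → List (Sym k) → List Event → List Event → ℕ → ℕ
rT σ rd opt t = count (λ i → inAOPT (length σ) rd opt t i ∧ not (inA rd t i)) (upTo (length σ))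

S : {k : ℕ} → List (Sym k) → List Event → ℕ → List (Sym k)
S σ rd t = map proj₂ (filterᵇ (λ x → not (any (isDel (proj₁ x)) (upToTime t rd))) (zip (upTo (length σ)) σ))

-- Keep the indices that Random-deletion has matched by time t, together with the
-- indices outside A_t^OPT that the optimal algorithm leaves undeleted.  They come in
-- congruent pairs (matched by Random-deletion, or by the optimal algorithm with both
-- ends outside A_t^OPT), and no two pairs cross: the matches of one run are nested,
-- and an index strictly inside a pair matched by Random-deletion is processed before
-- that match, hence lies in A_t.  A word carrying such a perfect non-crossing
-- matching is balanced.  Every other symbol of S_t lies in A_t^OPT \ A_t, or is
-- deleted by the optimal algorithm outside A_t^OPT, and there are r_t and d - d_t
-- of those respectively.
module Submission where

open import Defs
open import Data.Bool using (Bool; true; false; T; T?; _∧_; _∨_; not)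
open import Data.Bool.ListAction using (any)
open import Data.Bool.Properties using (T-∨; T-∧)
open import Data.Nat using (ℕ; suc; _+_; _∸_; _<_; _>_; _≤_; _≡ᵇ_; z≤n; s≤s)
open import Data.Nat.Properties
open import Data.Fin using (Fin)
open import Data.Fin.Properties using () renaming (_≟_ to _≟F_)
open import Data.List using (List; []; _∷_; _++_; map; length; filterᵇ; zip; upTo; applyUpTo; drop)
open import Data.List.Properties using (length-++; map-++; ++-assoc; length-upTo; take++drop≡id)
open import Data.List.Membership.Propositional using (_∈_; lose; find)
open import Data.List.Membership.Propositional.Properties
  using (∈-∃++; ∈-++⁺ˡ; ∈-++⁺ʳ; ∈-++⁻; ∈-map⁺; ∈-filter⁺; ∈-filter⁻; ∈-upTo⁺; ∈-upTo⁻)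
open import Data.List.Relation.Unary.Any using (Any; here; there)
open import Data.List.Relation.Unary.Any.Properties using (any⁺; any⁻; ++⁺ˡ)
open import Data.List.Relation.Unary.All as All using (All; []; _∷_)
import Data.List.Relation.Unary.All.Properties as All
open import Data.List.Relation.Unary.AllPairs as AllPairs using (AllPairs; []; _∷_)
import Data.List.Relation.Unary.AllPairs.Properties as AllPairs
open import Data.List.Relation.Unary.Unique.Propositional using (Unique)
open import Data.List.Relation.Unary.Unique.Propositional.Properties using (upTo⁺)
open import Data.List.Relation.Binary.Sublist.Propositional using (⊆-refl)
import Data.List.Relation.Binary.Sublist.Propositional as Sublist
import Data.List.Relation.Binary.Sublist.Propositional.Properties as Sublist
open import Data.Product using (Σ; ∃-syntax; _×_; _,_; proj₁; proj₂; uncurry)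
open import Data.Sum using (_⊎_; inj₁; inj₂; [_,_]′)
import Data.Sum as Sum
open import Data.Empty using (⊥; ⊥-elim)
open import Function using (_∘_; _on_; id; Equivalence; _⇔_; mk⇔)
open import Relation.Nullary using (yes; no; ¬_)
open import Relation.Binary.PropositionalEquality using (_≡_; _≢_; refl; sym; trans; cong; cong₂; subst; module ≡-Reasoning)

open Equivalence using (to; from)
T-not⇒¬T : ∀ {b} → T (not b) → ¬ T b
T-not⇒¬T {true} ()

¬T⇒T-not : ∀ {b} → ¬ T b → T (not b)
¬T⇒T-not {true} ¬b = ¬b _
¬T⇒T-not {false} _ = _

count-mono : ∀ {f g : ℕ → Bool} xs → (∀ {x} → T (f x) → T (g x)) → count f xs ≤ count g xs
count-mono xs f⇒g = Sublist.length-mono-≤ (Sublist.filter⁺ (T? ∘ _) (T? ∘ _) (λ { refl → f⇒g }) (⊆-refl {x = xs}))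

count-∨ : ∀ (f g : ℕ → Bool) xs → count (λ x → f x ∨ g x) xs ≤ count f xs + count g xs
count-∨ f g [] = z≤n
count-∨ f g (x ∷ xs) with f x | g x
... | true  | true  = s≤s (≤-trans (m≤n⇒m≤1+n (count-∨ f g xs)) (≤-reflexive (sym (+-suc _ _))))
... | true  | false = s≤s (count-∨ f g xs)
... | false | true  = ≤-trans (s≤s (count-∨ f g xs)) (≤-reflexive (sym (+-suc _ _)))
... | false | false = count-∨ f g xs

count-∨-disjoint : ∀ (f g : ℕ → Bool) xs → (∀ {x} → x ∈ xs → T (f x) → T (g x) → ⊥) →
                   count (λ x → f x ∨ g x) xs ≡ count f xs + count g xs
count-∨-disjoint f g [] _ = refl
count-∨-disjoint f g (x ∷ xs) disjoint with f x in fx | g x in gx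
... | true  | true  = ⊥-elim (disjoint (here refl) (subst T (sym fx) _) (subst T (sym gx) _))
... | true  | false = cong suc (count-∨-disjoint f g xs (disjoint ∘ there))
... | false | true  = trans (cong suc (count-∨-disjoint f g xs (disjoint ∘ there))) (sym (+-suc _ _))
... | false | false = count-∨-disjoint f g xs (disjoint ∘ there)

count-split : ∀ (g f : ℕ → Bool) xs → count f xs ≡ count (λ x → g x ∧ f x) xs + count (λ x → not (g x) ∧ f x) xs
count-split g f [] = refl
count-split g f (x ∷ xs) with g x | f x
... | true  | true  = cong suc (count-split g f xs)
... | true  | false = count-split g f xs
... | false | true  = trans (cong suc (count-split g f xs)) (sym (+-suc _ _))
... | false | false = count-split g f xs

count-none : ∀ {f} xs → (∀ {y} → y ∈ xs → ¬ T (f y)) → count f xs ≡ 0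
count-none [] _ = refl
count-none {f} (x ∷ xs) none with f x in fx
... | true  = ⊥-elim (none (here refl) (subst T (sym fx) _))
... | false = count-none xs (none ∘ there)

count-≡ᵇ : ∀ {j} xs → Unique xs → j ∈ xs → count (_≡ᵇ j) xs ≡ 1
count-≡ᵇ {j} (x ∷ xs) (x∉xs ∷ _) (here refl) with x ≡ᵇ x in eq
... | true  = cong suc (count-none xs λ y∈xs y≡x → All.lookup x∉xs y∈xs (sym (≡ᵇ⇒≡ _ _ y≡x)))
... | false = ⊥-elim (subst T eq (≡⇒≡ᵇ x x refl))
count-≡ᵇ {j} (x ∷ xs) (x≢xs ∷ unique) (there j∈xs) with x ≡ᵇ j in eq
... | true  = ⊥-elim (All.lookup x≢xs j∈xs (≡ᵇ⇒≡ x j (subst T (sym eq) _)))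
... | false = count-≡ᵇ xs unique j∈xs

Touches : ℕ → Event → Set
Touches i e = T (touches i e)

Touched : List Event → ℕ → Set
Touched es i = Any (Touches i) es

touches-del⁻ : ∀ {i j} → Touches i (del j) → i ≡ j
touches-del⁻ {i} {j} = ≡ᵇ⇒≡ i j

touches-mat⁻ : ∀ {i j l} → Touches i (mat j l) → i ≡ j ⊎ i ≡ l
touches-mat⁻ {i} {j} {l} t with to T-∨ t
... | inj₁ i≡j = inj₁ (≡ᵇ⇒≡ i j i≡j)
... | inj₂ i≡l = inj₂ (≡ᵇ⇒≡ i l i≡l)

touches-del : ∀ j → Touches j (del j)
touches-del j = ≡⇒≡ᵇ j j refl

touches-matˡ : ∀ j l → Touches j (mat j l)
touches-matˡ j l = from T-∨ (inj₁ (≡⇒≡ᵇ j j refl))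

touches-matʳ : ∀ j l → Touches l (mat j l)
touches-matʳ j l = from T-∨ (inj₂ (≡⇒≡ᵇ l l refl))

Disjoint : Event → Event → Set
Disjoint e e′ = ∀ {i} → Touches i e → Touches i e′ → ⊥


mat-injective : ∀ {a b c d} → mat a b ≡ mat c d → a ≡ c × b ≡ d
mat-injective refl = refl , refl

matchTouches : ℕ → Event → Bool
matchTouches i (del _) = false
matchTouches i (mat j l) = touches i (mat j l)

disjoint-touches-once : ∀ {es i e e′} → AllPairs Disjoint es → e ∈ es → e′ ∈ es → Touches i e → Touches i e′ → e ≡ e′
disjoint-touches-once _ (here refl) (here refl) _ _ = refl
disjoint-touches-once (e# ∷ _) (here refl) (there e′∈) t t′ = ⊥-elim (All.lookup e# e′∈ t t′)
disjoint-touches-once (e′# ∷ _) (there e∈) (here refl) t t′ = ⊥-elim (All.lookup e′# e∈ t′ t)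
disjoint-touches-once (_ ∷ es#) (there e∈) (there e′∈) = disjoint-touches-once es# e∈ e′∈

numDel≡count : ∀ {es xs} → AllPairs Disjoint es → (∀ {j} → del j ∈ es → j ∈ xs) → Unique xs →
               numDel es ≡ count (λ i → any (isDel i) es) xs
numDel≡count {[]} {xs} _ _ _ = sym (count-none xs λ _ ())
numDel≡count {mat _ _ ∷ es} (_ ∷ es#) bounded unique = numDel≡count es# (bounded ∘ there) unique
numDel≡count {del j ∷ es} {xs} (j# ∷ es#) bounded unique = sym (begin
  count (λ i → (i ≡ᵇ j) ∨ any (isDel i) es) xs              ≡⟨ count-∨-disjoint (_≡ᵇ j) (λ i → any (isDel i) es) xs once ⟩
  count (_≡ᵇ j) xs + count (λ i → any (isDel i) es) xs      ≡⟨ cong₂ _+_ (count-≡ᵇ xs unique (bounded (here refl)))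
                                                                         (sym (numDel≡count es# (bounded ∘ there) unique)) ⟩
  suc (numDel es)                                           ∎)
  where
  open ≡-Reasoning
  once : ∀ {i} → i ∈ xs → T (i ≡ᵇ j) → T (any (isDel i) es) → ⊥
  once {i} _ i≡j deleted with find (any⁻ (isDel i) es deleted)
  ... | del l , d∈ , t = All.lookup j# d∈ {i} i≡j t

indices : ∀ {A : Set} → List (ℕ × A) → List ℕ
indices = map proj₁

numbered : ∀ {A : Set} → List A → List (ℕ × A)
numbered xs = zip (upTo (length xs)) xs

indexed : ∀ {A : Set} → ℕ → List A → List (ℕ × A)
indexed p [] = []
indexed p (x ∷ xs) = (p , x) ∷ indexed (suc p) xs

zip-applyUpTo≡indexed : ∀ {A : Set} (f : ℕ → ℕ) p (xs : List A) → (∀ i → f i ≡ p + i) →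
                        zip (applyUpTo f (length xs)) xs ≡ indexed p xs
zip-applyUpTo≡indexed f p [] _ = refl
zip-applyUpTo≡indexed f p (x ∷ xs) f≗p+ =
  cong₂ (λ q ys → (q , x) ∷ ys) (trans (f≗p+ 0) (+-identityʳ p))
        (zip-applyUpTo≡indexed (f ∘ suc) (suc p) xs (λ i → trans (f≗p+ (suc i)) (+-suc p i)))

map-proj₁-zip : ∀ {A B : Set} (xs : List A) (ys : List B) → length xs ≡ length ys → map proj₁ (zip xs ys) ≡ xs
map-proj₁-zip [] _ _ = refl
map-proj₁-zip (x ∷ xs) (y ∷ ys) eq = cong (x ∷_) (map-proj₁-zip xs ys (suc-injective eq))

indexed-above : ∀ {A : Set} p (xs : List A) → All (p ≤_) (indices (indexed p xs))
indexed-above p [] = []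
indexed-above p (x ∷ xs) = ≤-refl ∷ All.map <⇒≤ (indexed-above (suc p) xs)

indexed-ascending : ∀ {A : Set} p (xs : List A) → AllPairs _<_ (indices (indexed p xs))
indexed-ascending p [] = []
indexed-ascending p (x ∷ xs) = indexed-above (suc p) xs ∷ indexed-ascending (suc p) xs

length-filter-indices : ∀ {A : Set} (f : ℕ → Bool) (w : List (ℕ × A)) →
                        length (map proj₂ (filterᵇ (f ∘ proj₁) w)) ≡ count f (indices w)
length-filter-indices f [] = refl
length-filter-indices f ((x , _) ∷ w) with f x
... | true  = cong suc (length-filter-indices f w)
... | false = length-filter-indices f w

AllPairs-split : ∀ {A : Set} {R : A → A → Set} xs {y ys} → AllPairs R (xs ++ y ∷ ys) →
                 AllPairs R xs × AllPairs R ys × All (λ x → R x y) xs × All (R y) ys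
AllPairs-split [] (y<ys ∷ ys) = [] , ys , [] , y<ys
AllPairs-split (x ∷ xs) (x<xs+ys ∷ rs) with AllPairs-split xs rs
... | xs-pairs , ys-pairs , xs<y , y<ys =
  All.++⁻ˡ xs x<xs+ys ∷ xs-pairs , ys-pairs , All.head (All.++⁻ʳ xs x<xs+ys) ∷ xs<y , y<ys

Ascending : ∀ {A : Set} → List (ℕ × A) → Set
Ascending = AllPairs (_<_ on proj₁)

ascending-functional : ∀ {A : Set} {w : List (ℕ × A)} {x s s′} → Ascending w → (x , s) ∈ w → (x , s′) ∈ w → s ≡ s′
ascending-functional _ (here refl) (here refl) = refl
ascending-functional (x< ∷ _) (here refl) (there x∈) = ⊥-elim (<-irrefl refl (All.lookup x< x∈))
ascending-functional (x< ∷ _) (there x∈) (here refl) = ⊥-elim (<-irrefl refl (All.lookup x< x∈))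
ascending-functional (_ ∷ asc) (there x∈) (there x∈′) = ascending-functional asc x∈ x∈′

module _ {k : ℕ} (_⌢_ : ℕ → ℕ → Set) where

  Congruent : List (ℕ × Sym k) → Set
  Congruent w = ∀ {x y s s′} → x ⌢ y → (x , s) ∈ w → (y , s′) ∈ w → ∃[ a ] s ≡ op a × s′ ≡ cl a

  Covered : List (ℕ × Sym k) → Set
  Covered w = ∀ {x s} → (x , s) ∈ w → ∃[ y ] ∃[ s′ ] (y , s′) ∈ w × (x ⌢ y ⊎ y ⌢ x)

  module _ (⌢⇒< : ∀ {x y} → x ⌢ y → x < y)
           (⌢-functional : ∀ {x y z} → x ⌢ y → x ⌢ z → y ≡ z)
           (⌢-injective : ∀ {x y z} → x ⌢ z → y ⌢ z → x ≡ y)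
           (⌢-noncrossing : ∀ {q p i j} → q ⌢ p → i ⌢ j → q < i → i < p → p < j → ⊥)
           where

    ⌢-irrefl : ∀ {x} → x ⌢ x → ⊥
    ⌢-irrefl x⌢x = <-irrefl refl (⌢⇒< x⌢x)

    ⌢-asym : ∀ {x y} → x ⌢ y → y < x → ⊥
    ⌢-asym x⌢y = <-asym (⌢⇒< x⌢y)

    module _ {x y s₀ s₁} (mid rest : List (ℕ × Sym k)) (x⌢y : x ⌢ y)
             (asc : Ascending ((x , s₀) ∷ mid ++ (y , s₁) ∷ rest))
             (covered : Covered ((x , s₀) ∷ mid ++ (y , s₁) ∷ rest))
             where

      private
        x<mid : ∀ {e} → e ∈ mid → x < proj₁ e
        x<mid = All.lookup (AllPairs.head asc) ∘ ∈-++⁺ˡ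
        x<rest : ∀ {e} → e ∈ rest → x < proj₁ e
        x<rest = All.lookup (AllPairs.head asc) ∘ ∈-++⁺ʳ mid ∘ there
        mid<y : ∀ {e} → e ∈ mid → proj₁ e < y
        mid<y = All.lookup (proj₁ (proj₂ (proj₂ (AllPairs-split mid (AllPairs.tail asc)))))
        y<rest : ∀ {e} → e ∈ rest → y < proj₁ e
        y<rest = All.lookup (proj₂ (proj₂ (proj₂ (AllPairs-split mid (AllPairs.tail asc)))))

      covered-inside : Covered mid
      covered-inside {z} z∈mid with covered (there (∈-++⁺ˡ z∈mid))
      ... | _ , _ , here refl , pair =
        ⊥-elim ([ (λ z⌢x → ⌢-asym z⌢x (x<mid z∈mid))
                , (λ x⌢z → <-irrefl (sym (⌢-functional x⌢y x⌢z)) (mid<y z∈mid)) ]′ pair)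
      ... | u , t , there u∈ , pair with ∈-++⁻ mid u∈
      ...   | inj₁ u∈mid = u , t , u∈mid , pair
      ...   | inj₂ (here refl) =
        ⊥-elim ([ (λ z⌢y → <-irrefl (⌢-injective x⌢y z⌢y) (x<mid z∈mid))
                , (λ y⌢z → ⌢-asym y⌢z (mid<y z∈mid)) ]′ pair)
      ...   | inj₂ (there u∈rest) =
        ⊥-elim ([ (λ z⌢u → ⌢-noncrossing x⌢y z⌢u (x<mid z∈mid) (mid<y z∈mid) (y<rest u∈rest))
                , (λ u⌢z → ⌢-asym u⌢z (<-trans (mid<y z∈mid) (y<rest u∈rest))) ]′ pair)

      covered-outside : (∀ {z t} → (z , t) ∈ rest → ¬ y ⌢ z) → Covered rest
      covered-outside y-closes {z} z∈rest with covered (there (∈-++⁺ʳ mid (there z∈rest)))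
      ... | _ , _ , here refl , pair =
        ⊥-elim ([ (λ z⌢x → ⌢-asym z⌢x (x<rest z∈rest))
                , (λ x⌢z → <-irrefl (⌢-functional x⌢y x⌢z) (y<rest z∈rest)) ]′ pair)
      ... | u , t , there u∈ , pair with ∈-++⁻ mid u∈
      ...   | inj₁ u∈mid =
        ⊥-elim ([ (λ z⌢u → ⌢-asym z⌢u (<-trans (mid<y u∈mid) (y<rest z∈rest)))
                , (λ u⌢z → ⌢-noncrossing x⌢y u⌢z (x<mid u∈mid) (mid<y u∈mid) (y<rest z∈rest)) ]′ pair)
      ...   | inj₂ (here refl) = ⊥-elim ([ (λ z⌢y → ⌢-asym z⌢y (y<rest z∈rest)) , y-closes z∈rest ]′ pair)
      ...   | inj₂ (there u∈rest) = u , t , u∈rest , pair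

    balanced : ∀ n w → length w ≤ n → Ascending w → Congruent w → Covered w → Balanced (map proj₂ w)
    balanced n [] _ _ _ _ = bal-ε
    balanced (suc n) ((x , s) ∷ w) (s≤s |w|≤n) asc congruent covered with covered (here refl)
    ... | y , _ , here refl , x⌢x = ⊥-elim ([ ⌢-irrefl , ⌢-irrefl ]′ x⌢x)
    ... | y , _ , there y∈w , inj₂ y⌢x = ⊥-elim (⌢-asym y⌢x (All.lookup (AllPairs.head asc) y∈w))
    ... | y , _ , there y∈w , inj₁ x⌢y with ∈-∃++ y∈w
    ... | mid , rest , refl with congruent x⌢y (here refl) (there y∈w) | AllPairs-split mid (AllPairs.tail asc)
    ... | a , refl , refl | asc-mid , asc-rest , _ , _ =
      subst Balanced shape
        (bal-cat (bal-wrap a (balanced n mid |mid|≤n asc-mid (restrict (there ∘ ∈-++⁺ˡ)) (covered-inside mid rest x⌢y asc covered)))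
                 (balanced n rest |rest|≤n asc-rest (restrict (there ∘ ∈-++⁺ʳ mid ∘ there))
                    (covered-outside mid rest x⌢y asc covered y-closes)))
      where
      restrict : ∀ {v} → (∀ {e} → e ∈ v → e ∈ (x , op a) ∷ mid ++ (y , cl a) ∷ rest) → Congruent v
      restrict v⊆ z⌢u z∈ u∈ = congruent z⌢u (v⊆ z∈) (v⊆ u∈)

      y-closes : ∀ {z t} → (z , t) ∈ rest → ¬ y ⌢ z
      y-closes z∈rest y⌢z with congruent y⌢z (there y∈w) (there (∈-++⁺ʳ mid (there z∈rest)))
      ... | _ , () , _

      |mid|≤n : length mid ≤ n
      |mid|≤n = ≤-trans (m≤m+n (length mid) _) (≤-trans (≤-reflexive (sym (length-++ mid))) |w|≤n)
      |rest|≤n : length rest ≤ n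
      |rest|≤n = ≤-trans (n≤1+n _) (≤-trans (m≤n+m _ (length mid)) (≤-trans (≤-reflexive (sym (length-++ mid))) |w|≤n))

      shape : (op a ∷ map proj₂ mid ++ cl a ∷ []) ++ map proj₂ rest ≡ map proj₂ ((x , op a) ∷ mid ++ (y , cl a) ∷ rest)
      shape = cong (op a ∷_) (trans (++-assoc (map proj₂ mid) _ _) (sym (map-++ proj₂ mid _)))

module _ {k : ℕ} where

  Stack : Set
  Stack = List (ℕ × Fin k)

  Word : Set
  Word = List (ℕ × Sym k)

  -- scan with positions attached to the input and the coins forgotten: on a
  -- mismatch either deletion may happen.
  data Run : Stack → Word → List Event → Set where
    done      : Run [] [] []
    flush     : ∀ {q a st es} → Run st [] es → Run ((q , a) ∷ st) [] (del q ∷ es)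
    push      : ∀ {p a st w es} → Run ((p , a) ∷ st) w es → Run st ((p , op a) ∷ w) es
    match     : ∀ {q p a st w es} → Run st w es → Run ((q , a) ∷ st) ((p , cl a) ∷ w) (mat q p ∷ es)
    popOpen   : ∀ {q b p a st w es} → Run st ((p , cl a) ∷ w) es → Run ((q , b) ∷ st) ((p , cl a) ∷ w) (del q ∷ es)
    dropClose : ∀ {p a st w es} → Run st w es → Run st ((p , cl a) ∷ w) (del p ∷ es)

  mutual
    scan-Run : ∀ c m p st σ → Run st (indexed p σ) (scan c m p st σ)
    scan-Run c m p [] [] = done
    scan-Run c m p ((q , a) ∷ st) [] = flush (scan-Run c m p st [])
    scan-Run c m p st (op a ∷ σ) = push (scan-Run c m (suc p) ((p , a) ∷ st) σ)
    scan-Run c m p st (cl a ∷ σ) = closeStep-Run c m p a st σ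

    closeStep-Run : ∀ c m p a st σ → Run st (indexed p (cl a ∷ σ)) (closeStep c m p a st σ)
    closeStep-Run c m p a [] σ = dropClose (scan-Run c m (suc p) [] σ)
    closeStep-Run c m p a ((q , b) ∷ st) σ with b ≟F a
    ... | yes refl = match (scan-Run c m (suc p) st σ)
    ... | no _ with c m
    ...   | true  = popOpen (closeStep-Run c (suc m) p a st σ)
    ...   | false = dropClose (scan-Run c (suc m) (suc p) ((q , b) ∷ st) σ)

  data Pending (st : Stack) (w : Word) (i : ℕ) : Set where
    stacked : i ∈ indices st → Pending st w i
    unread  : i ∈ indices w → Pending st w i

  pending-top⁻ : ∀ {q a st w i} → Pending ((q , a) ∷ st) w i → i ≡ q ⊎ Pending st w i
  pending-top⁻ (stacked (here i≡q)) = inj₁ i≡q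
  pending-top⁻ (stacked (there i∈st)) = inj₂ (stacked i∈st)
  pending-top⁻ (unread i∈w) = inj₂ (unread i∈w)

  pending-head⁻ : ∀ {p s st w i} → Pending st ((p , s) ∷ w) i → i ≡ p ⊎ Pending st w i
  pending-head⁻ (stacked i∈st) = inj₂ (stacked i∈st)
  pending-head⁻ (unread (here i≡p)) = inj₁ i≡p
  pending-head⁻ (unread (there i∈w)) = inj₂ (unread i∈w)

  pending-top⁺ : ∀ {q a st w i} → Pending st w i → Pending ((q , a) ∷ st) w i
  pending-top⁺ (stacked i∈st) = stacked (there i∈st)
  pending-top⁺ (unread i∈w) = unread i∈w

  pending-head⁺ : ∀ {p s st w i} → Pending st w i → Pending st ((p , s) ∷ w) i
  pending-head⁺ (stacked i∈st) = stacked i∈st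
  pending-head⁺ (unread i∈w) = unread (there i∈w)

  pending-push : ∀ {p a st w i} → Pending ((p , a) ∷ st) w i → Pending st ((p , op a) ∷ w) i
  pending-push = [ unread ∘ here , pending-head⁺ ]′ ∘ pending-top⁻

  pending-pull : ∀ {p a st w i} → Pending st ((p , op a) ∷ w) i → Pending ((p , a) ∷ st) w i
  pending-pull = [ stacked ∘ here , pending-top⁺ ]′ ∘ pending-head⁻

  touched⇒pending : ∀ {st w es i} → Run st w es → Touched es i → Pending st w i
  touched⇒pending done ()
  touched⇒pending (flush r) (here t) = stacked (here (touches-del⁻ t))
  touched⇒pending (flush r) (there t) = pending-top⁺ (touched⇒pending r t)
  touched⇒pending (push r) t = pending-push (touched⇒pending r t)
  touched⇒pending (match r) (here t) = [ stacked ∘ here , unread ∘ here ]′ (touches-mat⁻ t)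
  touched⇒pending (match r) (there t) = pending-top⁺ (pending-head⁺ (touched⇒pending r t))
  touched⇒pending (popOpen r) (here t) = stacked (here (touches-del⁻ t))
  touched⇒pending (popOpen r) (there t) = pending-top⁺ (touched⇒pending r t)
  touched⇒pending (dropClose r) (here t) = unread (here (touches-del⁻ t))
  touched⇒pending (dropClose r) (there t) = pending-head⁺ (touched⇒pending r t)

  pending⇒touched : ∀ {st w es i} → Run st w es → Pending st w i → Touched es i
  pending⇒touched done (stacked ())
  pending⇒touched done (unread ())
  pending⇒touched (flush {q = q} r) =
    [ (λ { refl → here (touches-del q) }) , there ∘ pending⇒touched r ]′ ∘ pending-top⁻
  pending⇒touched (push r) = pending⇒touched r ∘ pending-pull
  pending⇒touched (match {q = q} {p} r) =
    [ (λ { refl → here (touches-matˡ q p) })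
    , [ (λ { refl → here (touches-matʳ q p) }) , there ∘ pending⇒touched r ]′ ∘ pending-head⁻ ]′
    ∘ pending-top⁻
  pending⇒touched (popOpen {q = q} r) =
    [ (λ { refl → here (touches-del q) }) , there ∘ pending⇒touched r ]′ ∘ pending-top⁻
  pending⇒touched (dropClose {p = p} r) =
    [ (λ { refl → here (touches-del p) }) , there ∘ pending⇒touched r ]′ ∘ pending-head⁻

  record Ordered (st : Stack) (w : Word) : Set where
    field
      descending : AllPairs _>_ (indices st)
      below      : All (λ q → All (q <_) (indices w)) (indices st)
      ascending  : AllPairs _<_ (indices w)
  open Ordered

  ordered-pop : ∀ {q a st w} → Ordered ((q , a) ∷ st) w → Ordered st w
  ordered-pop o = record
    { descending = AllPairs.tail (descending o)
    ; below      = All.tail (below o)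
    ; ascending  = ascending o
    }

  ordered-next : ∀ {p s st w} → Ordered st ((p , s) ∷ w) → Ordered st w
  ordered-next o = record
    { descending = descending o
    ; below      = All.map All.tail (below o)
    ; ascending  = AllPairs.tail (ascending o)
    }

  ordered-push : ∀ {p a s st w} → Ordered st ((p , s) ∷ w) → Ordered ((p , a) ∷ st) w
  ordered-push o = record
    { descending = All.map All.head (below o) ∷ descending o
    ; below      = AllPairs.head (ascending o) ∷ All.map All.tail (below o)
    ; ascending  = AllPairs.tail (ascending o)
    }

  top<head : ∀ {q a p s st w} → Ordered ((q , a) ∷ st) ((p , s) ∷ w) → q < p
  top<head o = All.head (All.head (below o))

  top-separated : ∀ {q a st w x} → Ordered ((q , a) ∷ st) w → Pending st w x → x < q ⊎ q < x
  top-separated o (stacked x∈st) = inj₁ (All.lookup (AllPairs.head (descending o)) x∈st)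
  top-separated o (unread x∈w) = inj₂ (All.lookup (All.head (below o)) x∈w)

  head-separated : ∀ {p s st w x} → Ordered st ((p , s) ∷ w) → Pending st w x → x < p ⊎ p < x
  head-separated o (stacked x∈st) = inj₁ (All.lookup (All.map All.head (below o)) x∈st)
  head-separated o (unread x∈w) = inj₂ (All.lookup (AllPairs.head (ascending o)) x∈w)

  match-separated : ∀ {q a p s st w x} → Ordered ((q , a) ∷ st) ((p , s) ∷ w) → Pending st w x → x < q ⊎ p < x
  match-separated o (stacked x∈st) = inj₁ (All.lookup (AllPairs.head (descending o)) x∈st)
  match-separated o (unread x∈w) = inj₂ (All.lookup (AllPairs.head (ascending o)) x∈w)

  separated⇒≢ : ∀ {x q} → x < q ⊎ q < x → x ≢ q
  separated⇒≢ = [ <⇒≢ , >⇒≢ ]′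

  untouched : ∀ {st w es i} → Run st w es → (∀ {x} → Pending st w x → x ≢ i) → ¬ Touched es i
  untouched r fresh t = fresh (touched⇒pending r t) refl

  del-disjoint : ∀ {st w es q} → Run st w es → (∀ {x} → Pending st w x → x ≢ q) → All (Disjoint (del q)) es
  del-disjoint r fresh = All.tabulate λ e∈es {i} t t′ →
    untouched r fresh (subst (Touched _) (touches-del⁻ t) (lose e∈es t′))

  mat-disjoint : ∀ {st w es q p} → Run st w es →
    (∀ {x} → Pending st w x → x ≢ q) → (∀ {x} → Pending st w x → x ≢ p) → All (Disjoint (mat q p)) es
  mat-disjoint {q = q} {p} r fresh-q fresh-p = All.tabulate λ e∈es {i} t t′ →
    [ (λ { refl → untouched r fresh-q (lose e∈es t′) }) , (λ { refl → untouched r fresh-p (lose e∈es t′) }) ]′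
      (touches-mat⁻ {i} {q} {p} t)

  run-disjoint : ∀ {st w es} → Ordered st w → Run st w es → AllPairs Disjoint es
  run-disjoint o done = []
  run-disjoint o (flush r) = del-disjoint r (separated⇒≢ ∘ top-separated o) ∷ run-disjoint (ordered-pop o) r
  run-disjoint o (push r) = run-disjoint (ordered-push o) r
  run-disjoint o (match r) =
    mat-disjoint r (separated⇒≢ ∘ Sum.map₂ (<-trans (top<head o)) ∘ match-separated o)
                   (separated⇒≢ ∘ Sum.map₁ (λ x<q → <-trans x<q (top<head o)) ∘ match-separated o)
    ∷ run-disjoint (ordered-pop (ordered-next o)) r
  run-disjoint o (popOpen r) = del-disjoint r (separated⇒≢ ∘ top-separated o) ∷ run-disjoint (ordered-pop o) r
  run-disjoint o (dropClose r) = del-disjoint r (separated⇒≢ ∘ head-separated o) ∷ run-disjoint (ordered-next o) r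

  matched⇒< : ∀ {st w es q p} → Ordered st w → Run st w es → mat q p ∈ es → q < p
  matched⇒< o (flush r) (there m) = matched⇒< (ordered-pop o) r m
  matched⇒< o (push r) m = matched⇒< (ordered-push o) r m
  matched⇒< o (match r) (here refl) = top<head o
  matched⇒< o (match r) (there m) = matched⇒< (ordered-pop (ordered-next o)) r m
  matched⇒< o (popOpen r) (there m) = matched⇒< (ordered-pop o) r m
  matched⇒< o (dropClose r) (there m) = matched⇒< (ordered-next o) r m

  OpenedAt : Stack → Word → ℕ → Fin k → Set
  OpenedAt st w q a = (q , a) ∈ st ⊎ (q , op a) ∈ w

  opened-push : ∀ {p b st w q a} → OpenedAt ((p , b) ∷ st) w q a → OpenedAt st ((p , op b) ∷ w) q a
  opened-push (inj₁ (here refl)) = inj₂ (here refl)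
  opened-push (inj₁ (there m)) = inj₁ m
  opened-push (inj₂ m) = inj₂ (there m)

  matched-congruent : ∀ {st w es q p} → Run st w es → mat q p ∈ es →
                      ∃[ a ] OpenedAt st w q a × (p , cl a) ∈ w
  matched-congruent (match r) (here refl) = _ , inj₁ (here refl) , here refl
  matched-congruent (push r) m with matched-congruent r m
  ... | a , opened , closed = a , opened-push opened , there closed
  matched-congruent (flush r) (there m) with matched-congruent r m
  ... | a , opened , closed = a , Sum.map₁ there opened , closed
  matched-congruent (match r) (there m) with matched-congruent r m
  ... | a , opened , closed = a , Sum.map there there opened , there closed
  matched-congruent (popOpen r) (there m) with matched-congruent r m
  ... | a , opened , closed = a , Sum.map₁ there opened , closed
  matched-congruent (dropClose r) (there m) with matched-congruent r m
  ... | a , opened , closed = a , Sum.map₂ there opened , there closed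

  noncrossing : ∀ {st w es q p i j} → Ordered st w → Run st w es →
                mat q p ∈ es → mat i j ∈ es → q < i → i < p → p < j → ⊥
  noncrossing o (flush r) (there m₁) (there m₂) = noncrossing (ordered-pop o) r m₁ m₂
  noncrossing o (push r) m₁ m₂ = noncrossing (ordered-push o) r m₁ m₂
  noncrossing o (match r) (here refl) (here refl) q<i _ _ = <-irrefl refl q<i
  noncrossing {i = i} {j} o (match r) (here refl) (there m₂) q<i i<p _ =
    [ <-asym q<i , <-asym i<p ]′ (match-separated o (touched⇒pending r (lose m₂ (touches-matˡ i j))))
  noncrossing {q = q} {p} o (match r) (there m₁) (here refl) _ i<p p<j =
    [ <-asym i<p , <-asym p<j ]′ (match-separated o (touched⇒pending r (lose m₁ (touches-matʳ q p))))
  noncrossing o (match r) (there m₁) (there m₂) = noncrossing (ordered-pop (ordered-next o)) r m₁ m₂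
  noncrossing o (popOpen r) (there m₁) (there m₂) = noncrossing (ordered-pop o) r m₁ m₂
  noncrossing o (dropClose r) (there m₁) (there m₂) = noncrossing (ordered-next o) r m₁ m₂

  matched-encloses : ∀ {st w es q p x} → Ordered st w → Run st w es → ∀ pre {post} →
                     es ≡ pre ++ mat q p ∷ post → q < x → x < p → Pending st w x → Touched pre x
  matched-encloses o done [] ()
  matched-encloses o done (_ ∷ _) ()
  matched-encloses o (flush {q = y} r) (_ ∷ pre) refl q<x x<p =
    [ (λ { refl → here (touches-del y) }) , there ∘ matched-encloses (ordered-pop o) r pre refl q<x x<p ]′
    ∘ pending-top⁻
  matched-encloses o (push r) pre eq q<x x<p =
    matched-encloses (ordered-push o) r pre eq q<x x<p ∘ pending-pull
  matched-encloses o (match r) [] refl q<x x<p = ⊥-elim ∘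
    [ (λ { refl → <-irrefl refl q<x })
    , [ (λ { refl → <-irrefl refl x<p }) , [ <-asym q<x , <-asym x<p ]′ ∘ match-separated o ]′ ∘ pending-head⁻ ]′
    ∘ pending-top⁻
  matched-encloses o (match {q = y} {z} r) (_ ∷ pre) refl q<x x<p =
    [ (λ { refl → here (touches-matˡ y z) })
    , [ (λ { refl → here (touches-matʳ y z) })
      , there ∘ matched-encloses (ordered-pop (ordered-next o)) r pre refl q<x x<p ]′ ∘ pending-head⁻ ]′
    ∘ pending-top⁻
  matched-encloses o (popOpen {q = y} r) (_ ∷ pre) refl q<x x<p =
    [ (λ { refl → here (touches-del y) }) , there ∘ matched-encloses (ordered-pop o) r pre refl q<x x<p ]′
    ∘ pending-top⁻
  matched-encloses o (dropClose {p = y} r) (_ ∷ pre) refl q<x x<p =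
    [ (λ { refl → here (touches-del y) }) , there ∘ matched-encloses (ordered-next o) r pre refl q<x x<p ]′
    ∘ pending-head⁻

module _ {k : ℕ} (σ : List (Sym k)) where

  numbered≡indexed : numbered σ ≡ indexed 0 σ
  numbered≡indexed = zip-applyUpTo≡indexed id 0 σ (λ _ → refl)

  indices-numbered : indices (numbered σ) ≡ upTo (length σ)
  indices-numbered = map-proj₁-zip (upTo (length σ)) σ (length-upTo (length σ))

  ordered-numbered : Ordered [] (numbered σ)
  ordered-numbered = record
    { descending = []
    ; below      = []
    ; ascending  = subst (AllPairs _<_ ∘ indices) (sym numbered≡indexed) (indexed-ascending 0 σ)
    }

  numbered-ascending : Ascending (numbered σ)
  numbered-ascending = AllPairs.map⁻ (Ordered.ascending ordered-numbered)

  numbered-functional : ∀ {x s s′} → (x , s) ∈ numbered σ → (x , s′) ∈ numbered σ → s ≡ s′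
  numbered-functional = ascending-functional numbered-ascending

  run-Run : ∀ c → Run [] (numbered σ) (run c σ)
  run-Run c = subst (λ w → Run [] w (run c σ)) (sym numbered≡indexed) (scan-Run c 0 0 [] σ)

  pending⇔< : ∀ {i} → Pending [] (numbered σ) i ⇔ i < length σ
  pending⇔< = mk⇔ (λ { (stacked ()) ; (unread i∈) → ∈-upTo⁻ (subst (_ ∈_) indices-numbered i∈) })
                  (unread ∘ subst (_ ∈_) (sym indices-numbered) ∘ ∈-upTo⁺)

  touched⇒< : ∀ c {i} → Touched (run c σ) i → i < length σ
  touched⇒< c = to pending⇔< ∘ touched⇒pending (run-Run c)

  <⇒touched : ∀ c {i} → i < length σ → Touched (run c σ) i
  <⇒touched c = pending⇒touched (run-Run c) ∘ from pending⇔<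

  touched-once : ∀ c {i e e′} → e ∈ run c σ → e′ ∈ run c σ → Touches i e → Touches i e′ → e ≡ e′
  touched-once c = disjoint-touches-once (run-disjoint ordered-numbered (run-Run c))

  matched-symbols : ∀ c {q p} → mat q p ∈ run c σ → ∃[ a ] (q , op a) ∈ numbered σ × (p , cl a) ∈ numbered σ
  matched-symbols c m with matched-congruent (run-Run c) m
  ... | a , inj₂ opened , closed = a , opened , closed

module Lemma5 {k : ℕ} (σ : List (Sym k)) (rdCoins optCoins : ℕ → Bool) (t : ℕ) where

  private
    n : ℕ
    n = length σ
    rd opt A : List Event
    rd  = run rdCoins σ
    opt = run optCoins σ
    A   = upToTime t rd

  InA InAOPT OptDeletes : ℕ → Set
  InA i        = T (inA rd t i)
  InAOPT i     = T (inAOPT n rd opt t i)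
  OptDeletes i = T (optDeletes opt i)

  A⊆rd : ∀ {e} → e ∈ A → e ∈ rd
  A⊆rd = Sublist.lookup (Sublist.take-⊆ t rd)

  touched⇒inA : ∀ {i} → Touched A i → InA i
  touched⇒inA = any⁺ _

  inA⇒inAOPT : ∀ {i} → InA i → InAOPT i
  inA⇒inAOPT = from T-∨ ∘ inj₁

  Partners : ℕ → ℕ → Set
  Partners i j = mat i j ∈ opt ⊎ mat j i ∈ opt

  partners-unique : ∀ {i j l} → Partners i j → Partners i l → j ≡ l
  partners-unique {i} {j} {l} = go
    where
    go : Partners i j → Partners i l → j ≡ l
    go (inj₁ m) (inj₁ m′) = proj₂ (mat-injective (touched-once σ optCoins {i} m m′ (touches-matˡ i j) (touches-matˡ i l)))
    go (inj₁ m) (inj₂ m′) with mat-injective (touched-once σ optCoins {i} m m′ (touches-matˡ i j) (touches-matʳ l i))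
    ... | refl , refl = refl
    go (inj₂ m) (inj₁ m′) with mat-injective (touched-once σ optCoins {i} m m′ (touches-matʳ j i) (touches-matˡ i l))
    ... | refl , refl = refl
    go (inj₂ m) (inj₂ m′) = proj₁ (mat-injective (touched-once σ optCoins {i} m m′ (touches-matʳ j i) (touches-matʳ l i)))

  partners⇒pairs : ∀ {i j} → Partners i j → Any (T ∘ pairs i j) opt
  partners⇒pairs {i} {j} (inj₁ m) = lose m (from T-∨ (inj₁ (from T-∧ (≡⇒≡ᵇ i i refl , ≡⇒≡ᵇ j j refl))))
  partners⇒pairs {i} {j} (inj₂ m) = lose m (from T-∨ (inj₂ (from T-∧ (≡⇒≡ᵇ j j refl , ≡⇒≡ᵇ i i refl))))

  pairs⇒partners : ∀ {i j e} → e ∈ opt → T (pairs i j e) → Partners i j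
  pairs⇒partners {i} {j} {mat a b} m p with to T-∨ p
  ... | inj₁ ab with to T-∧ ab
  ...   | a≡i , b≡j with ≡ᵇ⇒≡ a i a≡i | ≡ᵇ⇒≡ b j b≡j
  ...     | refl | refl = inj₁ m
  pairs⇒partners {i} {j} {mat a b} m p | inj₂ ba with to T-∧ ba
  ...   | a≡j , b≡i with ≡ᵇ⇒≡ a j a≡j | ≡ᵇ⇒≡ b i b≡i
  ...     | refl | refl = inj₂ m

  -- Either j ∈ A_t, or j is the partner of some l ∈ A_t, and then l = i.
  partner-inAOPT : ∀ {i j} → Partners i j → InAOPT j → InAOPT i
  partner-inAOPT {i} {j} partners inAOPT-j with to T-∨ inAOPT-j
  ... | inj₁ inA-j = from T-∨ (inj₂ (any⁺ _ (lose (∈-upTo⁺ j<n) (from T-∧ (inA-j , any⁺ _ (partners⇒pairs partners))))))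
    where
    j<n : j < n
    j<n = touched⇒< σ optCoins ([ (λ m → lose m (touches-matʳ i j)) , (λ m → lose m (touches-matˡ j i)) ]′ partners)
  ... | inj₂ via-l with find (any⁻ (λ l → inA rd t l ∧ any (pairs j l) opt) (upTo n) via-l)
  ...   | l , _ , inA-l∧pairs with to T-∧ inA-l∧pairs
  ...     | inA-l , pairs-jl with find (any⁻ (pairs j l) opt pairs-jl)
  ...       | _ , e∈opt , p = inA⇒inAOPT (subst InA (sym (partners-unique (Sum.swap partners) (pairs⇒partners e∈opt p))) inA-l)

  inAOPT-matchedˡ : ∀ {i j} → mat i j ∈ A → InAOPT i
  inAOPT-matchedˡ {i} {j} m = inA⇒inAOPT (touched⇒inA (lose m (touches-matˡ i j)))

  inAOPT-matchedʳ : ∀ {i j} → mat i j ∈ A → InAOPT j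
  inAOPT-matchedʳ {i} {j} m = inA⇒inAOPT (touched⇒inA (lose m (touches-matʳ i j)))

  inside-A : ∀ {q p x} → mat q p ∈ A → q < x → x < p → InA x
  inside-A {q} {p} {x} m q<x x<p with ∈-∃++ m
  ... | pre , post , A≡ = touched⇒inA (subst (λ es → Touched es x) (sym A≡) (++⁺ˡ enclosed))
    where
    open ≡-Reasoning
    rd≡ : rd ≡ pre ++ mat q p ∷ post ++ drop t rd
    rd≡ = begin
      rd                                ≡⟨ sym (take++drop≡id t rd) ⟩
      A ++ drop t rd                    ≡⟨ cong (_++ drop t rd) A≡ ⟩
      (pre ++ mat q p ∷ post) ++ drop t rd ≡⟨ ++-assoc pre _ _ ⟩
      pre ++ mat q p ∷ post ++ drop t rd ∎
    x<n : x < n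
    x<n = <-trans x<p (touched⇒< σ rdCoins (lose (A⊆rd m) (touches-matʳ q p)))
    enclosed : Touched pre x
    enclosed = matched-encloses (ordered-numbered σ) (run-Run σ rdCoins) pre rd≡ q<x x<p (from (pending⇔< σ) x<n)

  _⌢_ : ℕ → ℕ → Set
  i ⌢ j = mat i j ∈ A ⊎ (mat i j ∈ opt × ¬ InAOPT i × ¬ InAOPT j)

  ⌢⇒< : ∀ {x y} → x ⌢ y → x < y
  ⌢⇒< (inj₁ m) = matched⇒< (ordered-numbered σ) (run-Run σ rdCoins) (A⊆rd m)
  ⌢⇒< (inj₂ (m , _)) = matched⇒< (ordered-numbered σ) (run-Run σ optCoins) m

  ⌢-functional : ∀ {x y z} → x ⌢ y → x ⌢ z → y ≡ z
  ⌢-functional {x} {y} {z} (inj₁ m) (inj₁ m′) =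
    proj₂ (mat-injective (touched-once σ rdCoins {x} (A⊆rd m) (A⊆rd m′) (touches-matˡ x y) (touches-matˡ x z)))
  ⌢-functional {x} {y} {z} (inj₂ (m , _)) (inj₂ (m′ , _)) =
    proj₂ (mat-injective (touched-once σ optCoins {x} m m′ (touches-matˡ x y) (touches-matˡ x z)))
  ⌢-functional (inj₁ m) (inj₂ (_ , x∉ , _)) = ⊥-elim (x∉ (inAOPT-matchedˡ m))
  ⌢-functional (inj₂ (_ , x∉ , _)) (inj₁ m′) = ⊥-elim (x∉ (inAOPT-matchedˡ m′))

  ⌢-injective : ∀ {x y z} → x ⌢ z → y ⌢ z → x ≡ y
  ⌢-injective {x} {y} {z} (inj₁ m) (inj₁ m′) =
    proj₁ (mat-injective (touched-once σ rdCoins {z} (A⊆rd m) (A⊆rd m′) (touches-matʳ x z) (touches-matʳ y z)))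
  ⌢-injective {x} {y} {z} (inj₂ (m , _)) (inj₂ (m′ , _)) =
    proj₁ (mat-injective (touched-once σ optCoins {z} m m′ (touches-matʳ x z) (touches-matʳ y z)))
  ⌢-injective (inj₁ m) (inj₂ (_ , _ , z∉)) = ⊥-elim (z∉ (inAOPT-matchedʳ m))
  ⌢-injective (inj₂ (_ , _ , z∉)) (inj₁ m′) = ⊥-elim (z∉ (inAOPT-matchedʳ m′))

  ⌢-noncrossing : ∀ {q p i j} → q ⌢ p → i ⌢ j → q < i → i < p → p < j → ⊥
  ⌢-noncrossing (inj₁ m) (inj₁ m′) = noncrossing (ordered-numbered σ) (run-Run σ rdCoins) (A⊆rd m) (A⊆rd m′)
  ⌢-noncrossing (inj₂ (m , _)) (inj₂ (m′ , _)) = noncrossing (ordered-numbered σ) (run-Run σ optCoins) m m′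
  ⌢-noncrossing (inj₁ m) (inj₂ (_ , i∉ , _)) q<i i<p _ = i∉ (inA⇒inAOPT (inside-A m q<i i<p))
  ⌢-noncrossing (inj₂ (_ , _ , p∉)) (inj₁ m′) _ i<p p<j = p∉ (inA⇒inAOPT (inside-A m′ i<p p<j))

  ⌢-symbols : ∀ {x y} → x ⌢ y → ∃[ a ] (x , op a) ∈ numbered σ × (y , cl a) ∈ numbered σ
  ⌢-symbols (inj₁ m) = matched-symbols σ rdCoins (A⊆rd m)
  ⌢-symbols (inj₂ (m , _)) = matched-symbols σ optCoins m

  keep : ℕ → Bool
  keep i = any (matchTouches i) A ∨ (not (inAOPT n rd opt t i) ∧ not (optDeletes opt i))

  W : List (ℕ × Sym k)
  W = filterᵇ (keep ∘ proj₁) (numbered σ)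

  τ : List (Sym k)
  τ = map proj₂ W

  W⊆numbered : ∀ {e} → e ∈ W → e ∈ numbered σ
  W⊆numbered = proj₁ ∘ ∈-filter⁻ (T? ∘ keep ∘ proj₁) {xs = numbered σ}

  kept⇒∈W : ∀ {x s} → (x , s) ∈ numbered σ → T (keep x) → (x , s) ∈ W
  kept⇒∈W = ∈-filter⁺ (T? ∘ keep ∘ proj₁)

  ∈W⇒kept : ∀ {x s} → (x , s) ∈ W → T (keep x)
  ∈W⇒kept = proj₂ ∘ ∈-filter⁻ (T? ∘ keep ∘ proj₁) {xs = numbered σ}

  W-bounded : ∀ {x s} → (x , s) ∈ W → x < n
  W-bounded = to (pending⇔< σ) ∘ unread ∘ ∈-map⁺ proj₁ ∘ W⊆numbered

  W-congruent : Congruent _⌢_ W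
  W-congruent x⌢y x∈W y∈W with ⌢-symbols x⌢y
  ... | a , x-op , y-cl = a , numbered-functional σ (W⊆numbered x∈W) x-op , numbered-functional σ (W⊆numbered y∈W) y-cl

  kept-A-match : ∀ {a b} → mat a b ∈ A → T (keep a) × T (keep b)
  kept-A-match {a} {b} m = from T-∨ (inj₁ (any⁺ _ (lose m (touches-matˡ a b))))
                         , from T-∨ (inj₁ (any⁺ _ (lose m (touches-matʳ a b))))

  opt-matched-undeleted : ∀ {i a b} → mat a b ∈ opt → Touches i (mat a b) → ¬ OptDeletes i
  opt-matched-undeleted {i} m t deleted with find (any⁻ (isDel i) opt deleted)
  ... | del j , d∈ , t′ with touched-once σ optCoins {i} d∈ m t′ t
  ...   | ()

  kept-opt-match : ∀ {a b} → mat a b ∈ opt → ¬ InAOPT a → ¬ InAOPT b → T (keep a) × T (keep b)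
  kept-opt-match {a} {b} m a∉ b∉ =
      from T-∨ (inj₂ (from T-∧ (¬T⇒T-not a∉ , ¬T⇒T-not (opt-matched-undeleted m (touches-matˡ a b)))))
    , from T-∨ (inj₂ (from T-∧ (¬T⇒T-not b∉ , ¬T⇒T-not (opt-matched-undeleted m (touches-matʳ a b)))))

  HasPartner : ℕ → Set
  HasPartner x = ∃[ y ] ∃[ s′ ] (y , s′) ∈ W × (x ⌢ y ⊎ y ⌢ x)

  ⌢-partners : ∀ {a b} → a ⌢ b → T (keep a) → T (keep b) → HasPartner a × HasPartner b
  ⌢-partners {a} {b} a⌢b ka kb with ⌢-symbols a⌢b
  ... | s , a-op , b-cl = (b , cl s , kept⇒∈W b-cl kb , inj₁ a⌢b) , (a , op s , kept⇒∈W a-op ka , inj₂ a⌢b)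

  touching-partner : ∀ {x a b} → a ⌢ b → Touches x (mat a b) → T (keep a) → T (keep b) → HasPartner x
  touching-partner {x} {a} {b} a⌢b t ka kb with touches-mat⁻ {x} {a} {b} t
  ... | inj₁ refl = proj₁ (⌢-partners a⌢b ka kb)
  ... | inj₂ refl = proj₂ (⌢-partners a⌢b ka kb)

  opt-match-outside : ∀ {x a b} → mat a b ∈ opt → Touches x (mat a b) → ¬ InAOPT x → ¬ InAOPT a × ¬ InAOPT b
  opt-match-outside {x} {a} {b} m t x∉ with touches-mat⁻ {x} {a} {b} t
  ... | inj₁ refl = x∉ , x∉ ∘ partner-inAOPT (inj₁ m)
  ... | inj₂ refl = x∉ ∘ partner-inAOPT (inj₂ m) , x∉

  W-covered : Covered _⌢_ W
  W-covered {x} x∈W with to T-∨ (∈W⇒kept x∈W)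
  ... | inj₁ matched with find (any⁻ (matchTouches x) A matched)
  ...   | mat a b , m , t = uncurry (touching-partner (inj₁ m) t) (kept-A-match m)
  W-covered {x} x∈W | inj₂ outside with to T-∧ outside
  ... | x∉ , undeleted with find (<⇒touched σ optCoins (W-bounded x∈W))
  ...   | del j , m , t = ⊥-elim (T-not⇒¬T undeleted (any⁺ _ (lose m t)))
  ...   | mat a b , m , t with opt-match-outside m t (T-not⇒¬T x∉)
  ...     | a∉ , b∉ = uncurry (touching-partner (inj₂ (m , a∉ , b∉)) t) (kept-opt-match m a∉ b∉)

  τ-balanced : Balanced τ
  τ-balanced = balanced _⌢_ ⌢⇒< ⌢-functional ⌢-injective ⌢-noncrossing (length W) W ≤-refl
                 (AllPairs.filter⁺ (T? ∘ keep ∘ proj₁) (numbered-ascending σ)) W-congruent W-covered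

  private
    undeleted inA′ inAOPT′ optDel′ : ℕ → Bool
    undeleted i = not (any (isDel i) A)
    inA′ i      = inA rd t i
    inAOPT′ i   = inAOPT n rd opt t i
    optDel′ i   = optDeletes opt i

  RdDeletes : ℕ → Set
  RdDeletes i = T (any (isDel i) A)

  kept⇒undeleted : ∀ {i} → T (keep i) → ¬ RdDeletes i
  kept⇒undeleted {i} kept deleted with find (any⁻ (isDel i) A deleted) | to T-∨ kept
  ... | del j , d∈ , t | inj₁ matched with find (any⁻ (matchTouches i) A matched)
  ...   | mat a b , m , t′ with touched-once σ rdCoins {i} (A⊆rd d∈) (A⊆rd m) t t′
  ...     | ()
  kept⇒undeleted {i} kept deleted | del j , d∈ , t | inj₂ outside =
    T-not⇒¬T (proj₁ (to T-∧ outside)) (inA⇒inAOPT (touched⇒inA (lose d∈ t)))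

  τ⊆S : τ ⊆ S σ rd t
  τ⊆S = Sublist.map⁺ proj₂ (Sublist.filter⁺ (T? ∘ keep ∘ proj₁) (T? ∘ undeleted ∘ proj₁)
                              (λ { refl → ¬T⇒T-not ∘ kept⇒undeleted }) (⊆-refl {x = numbered σ}))

  touched-undeleted⇒matched : ∀ {i} → InA i → ¬ RdDeletes i → T (any (matchTouches i) A)
  touched-undeleted⇒matched {i} inA-i undeleted with find (any⁻ (touches i) A inA-i)
  ... | del j , m , t = ⊥-elim (undeleted (any⁺ _ (lose m t)))
  ... | mat a b , m , t = any⁺ _ (lose m t)

  undeleted⇒accounted : ∀ {i} → T (undeleted i) →
    T (keep i ∨ ((inAOPT′ i ∧ not (inA′ i)) ∨ (not (inAOPT′ i) ∧ optDel′ i)))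
  undeleted⇒accounted {i} u =
    accounting (any (matchTouches i) A) (inAOPT′ i) (optDel′ i) (inA′ i)
               (λ inA-i → touched-undeleted⇒matched inA-i (T-not⇒¬T u))
    where
    accounting : ∀ a b c d → (T d → T a) → T ((a ∨ (not b ∧ not c)) ∨ ((b ∧ not d) ∨ (not b ∧ c)))
    accounting true  b     c     d     _   = _
    accounting false true  c     true  d⇒a = d⇒a _
    accounting false true  c     false _   = _
    accounting false false true  d     _   = _
    accounting false false false d     _   = _

  length-S : length (S σ rd t) ≡ count undeleted (upTo n)
  length-S = trans (length-filter-indices undeleted (numbered σ)) (cong (count undeleted) (indices-numbered σ))

  length-τ : length τ ≡ count keep (upTo n)
  length-τ = trans (length-filter-indices keep (numbered σ)) (cong (count keep) (indices-numbered σ))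

  numDel-opt : numDel opt ≡ count optDel′ (upTo n)
  numDel-opt = numDel≡count (run-disjoint (ordered-numbered σ) (run-Run σ optCoins))
                            (λ {j} d∈ → ∈-upTo⁺ (touched⇒< σ optCoins (lose d∈ (touches-del j))))
                            (upTo⁺ n)

  d-dt : numDel opt ∸ dT σ rd opt t ≡ count (λ i → not (inAOPT′ i) ∧ optDel′ i) (upTo n)
  d-dt = begin
    numDel opt ∸ dT σ rd opt t                       ≡⟨ cong (_∸ dT σ rd opt t) (trans numDel-opt (count-split inAOPT′ optDel′ (upTo n))) ⟩
    dT σ rd opt t + count (λ i → not (inAOPT′ i) ∧ optDel′ i) (upTo n) ∸ dT σ rd opt t ≡⟨ m+n∸m≡n (dT σ rd opt t) _ ⟩
    count (λ i → not (inAOPT′ i) ∧ optDel′ i) (upTo n) ∎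
    where open ≡-Reasoning

  length-S≤ : length (S σ rd t) ≤ length τ + (rT σ rd opt t + (numDel opt ∸ dT σ rd opt t))
  length-S≤ = begin
    length (S σ rd t)                                  ≡⟨ length-S ⟩
    count undeleted (upTo n)                           ≤⟨ count-mono (upTo n) undeleted⇒accounted ⟩
    count (λ i → keep i ∨ (h₁ i ∨ h₂ i)) (upTo n)      ≤⟨ count-∨ keep (λ i → h₁ i ∨ h₂ i) (upTo n) ⟩
    count keep (upTo n) + count (λ i → h₁ i ∨ h₂ i) (upTo n) ≤⟨ +-monoʳ-≤ (count keep (upTo n)) (count-∨ h₁ h₂ (upTo n)) ⟩
    count keep (upTo n) + (count h₁ (upTo n) + count h₂ (upTo n)) ≡⟨ cong₂ (λ a b → a + (rT σ rd opt t + b)) (sym length-τ) (sym d-dt) ⟩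
    length τ + (rT σ rd opt t + (numDel opt ∸ dT σ rd opt t)) ∎
    where
    open ≤-Reasoning
    h₁ h₂ : ℕ → Bool
    h₁ i = inAOPT′ i ∧ not (inA′ i)
    h₂ i = not (inAOPT′ i) ∧ optDel′ i

lemma5 : {k : ℕ} (σ : List (Sym k)) (rdCoins optCoins : ℕ → Bool) →
         MinDeletions σ (numDel (run optCoins σ)) →
         (t : ℕ) →
         Σ (List (Sym k)) λ τ →
           τ ⊆ S σ (run rdCoins σ) t × Balanced τ ×
           length (S σ (run rdCoins σ) t) ≤
             length τ + (rT σ (run rdCoins σ) (run optCoins σ) t
                         + (numDel (run optCoins σ) ∸ dT σ (run rdCoins σ) (run optCoins σ) t))
lemma5 σ rdCoins optCoins _ t = τ , τ⊆S , τ-balanced , length-S≤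
  where open Lemma5 σ rdCoins optCoins t
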